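{- (The Strong Connectivity Lemma.) Let $N$ be a positive integer, let $p$ be a polyomino with at least $2$ cells, and let $P$ be a polyomino of minimum size among all polyominoes which contain at least $N$ instances of $p$. Let $G$ be the graph whose vertices are the instances of $p$ contained in $P$, with two instances adjacent if they share at least one cell. Then $G$ is connected.
   Context: Cells are the unit squares of the square lattice, indexed by integer coordinates $(x,y)$. A polyomino is a finite nonempty edge-connected set of cells; its size is its number of cells. Polyominoes are considered only up to translation (fixed polyominoes). For a polyomino shape $p$, an instance of $p$ is any set of cells that is a translate of $p$; an instance of $p$ in $P$ is such a set that is a subset of $P$. -}

module Defs where

open import Data.Integer using (ℤ; _+_; ∣_∣; _-_)
open import Data.Nat using (ℕ; _≤_)
open import Data.Product using (_×_; _,_; Σ; ∃; ∃-syntax; proj₁; proj₂)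
open import Data.List using (List; []; _∷_; map; length)
open import Data.List.Membership.Propositional using (_∈_)
open import Data.List.Relation.Unary.All using (All)
open import Data.List.Relation.Unary.Unique.Propositional using (Unique)
open import Relation.Binary.PropositionalEquality using (_≡_)
open import Relation.Binary.Construct.Closure.ReflexiveTransitive using (Star)

Cell : Set
Cell = ℤ × ℤ

-- Finite sets of cells are represented by duplicate-free lists;
-- membership is list membership and size is the length.
CellSet : Set
CellSet = List Cell

_⊆ₛ_ : CellSet → CellSet → Set
A ⊆ₛ B = ∀ {c} → c ∈ A → c ∈ B

size : CellSet → ℕ
size = length

EdgeAdj : Cell → Cell → Set
EdgeAdj (x₁ , y₁) (x₂ , y₂) = ∣ x₁ - x₂ ∣ Data.Nat.+ ∣ y₁ - y₂ ∣ ≡ 1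
  where import Data.Nat

AdjIn : CellSet → Cell → Cell → Set
AdjIn A a b = a ∈ A × b ∈ A × EdgeAdj a b

EdgeConnected : CellSet → Set
EdgeConnected A = ∀ {a b} → a ∈ A → b ∈ A → Star (AdjIn A) a b

record IsPolyomino (A : CellSet) : Set where
  field
    unique    : Unique A
    nonempty  : 1 ≤ length A
    connected : EdgeConnected A

shift : Cell → CellSet → CellSet
shift (tx , ty) A = map (λ { (x , y) → (x + tx , y + ty) }) A

InstanceAt : CellSet → CellSet → Cell → Set
InstanceAt p P t = shift t p ⊆ₛ P

-- P contains at least N instances of p: there are N distinct translation
-- vectors t with p + t ⊆ P (distinct vectors give distinct instances
-- since p is nonempty and finite).
HasAtLeastInstances : ℕ → CellSet → CellSet → Set
HasAtLeastInstances N p P =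
  Σ (List Cell) λ ts → length ts ≡ N × Unique ts × All (InstanceAt p P) ts

InstAdj : CellSet → CellSet → Cell → Cell → Set
InstAdj p P s t =
  InstanceAt p P s × InstanceAt p P t × ∃[ c ] (c ∈ shift s p × c ∈ shift t p)

InstanceGraphConnected : CellSet → CellSet → Set
InstanceGraphConnected p P =
  ∀ {s t} → InstanceAt p P s → InstanceAt p P t → Star (InstAdj p P) s t

{-# OPTIONS --safe #-}
module Submission where

-- Suppose the instance graph of P is disconnected and let A be the union of
-- the instances in the component of an instance s.  An instance outside that
-- component shares no cell with A, so it lies in the rest R of P.
-- Two polyominoes glue into one with a cell fewer and no fewer instances:
-- translate the second so that its lexicographically least cell lands on the
-- greatest cell of the first.  The copies then share exactly that cell, and
-- since p has two cells no instance lies in both.  Splitting off components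
-- and gluing recursively compacts R into a polyomino of at most |R| cells with
-- as many instances; gluing it to A yields a polyomino with N instances and
-- fewer than |P| cells, contradicting minimality.

open import Defs
open import Level using (_⊔_)
open import Function using (_∘_; id)
open import Data.Nat using (ℕ; zero; suc; pred; _+_; _≤_; _<_; z≤n; s≤s; NonZero; >-nonZero)
import Data.Nat.Properties as ℕP
open import Data.Nat.Induction using (<-rec)
open import Data.Integer as ℤ using (ℤ)
import Data.Integer.Properties as ℤP
open import Data.Integer.Tactic.RingSolver using (solve-∀)
open import Data.Product using (∃; ∃₂; ∃-syntax; _×_; _,_; proj₁; proj₂)
open import Data.Product.Properties using (≡-dec)
open import Data.Product.Relation.Binary.Lex.Strict using (×-strictTotalOrder)
open import Data.Product.Relation.Binary.Pointwise.NonDependent using (≡×≡⇒≡)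
open import Data.Sum using (_⊎_; inj₁; inj₂)
open import Data.Empty using (⊥; ⊥-elim)
open import Data.List using (List; []; _∷_; [_]; map; length; filter; _++_)
open import Data.List.Properties using (length-++; length-map; length-removeAt′; filter-notAll)
open import Data.List.Relation.Unary.Any as Any using (Any; here; there; any?)
open import Data.List.Relation.Unary.All as All using (All; []; _∷_)
import Data.List.Relation.Unary.All.Properties as AllP
open import Data.List.Relation.Unary.Unique.Propositional using (Unique)
import Data.List.Relation.Unary.Unique.Propositional.Properties as UniqueP
open import Data.List.Relation.Unary.AllPairs using ([]; _∷_)
open import Data.List.Membership.Propositional using (_∈_; _∉_; _─_; find; lose)
open import Data.List.Membership.Propositional.Properties
  using (∈-map⁺; ∈-map⁻; ∈-++⁺ˡ; ∈-++⁺ʳ; ∈-++⁻; ∈-filter⁺; ∈-filter⁻; ∈-length)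
open import Data.List.Membership.DecPropositional (≡-dec ℤ._≟_ ℤ._≟_) using (_∈?_)
open import Relation.Binary using (Rel; Decidable; StrictTotalOrder; tri<; tri≈; tri>)
import Relation.Binary.Construct.Flip.EqAndOrd as Flip
open import Relation.Binary.PropositionalEquality
  using (_≡_; _≢_; refl; sym; trans; cong; cong₂; subst; subst₂; module ≡-Reasoning)
open import Relation.Binary.Construct.Closure.ReflexiveTransitive as Star using (Star; ε; _◅_; _◅◅_)
open import Relation.Nullary using (¬_; Dec; yes; no)
open import Relation.Unary using (Pred) renaming (Decidable to Decidable₁)
open import Relation.Unary.Properties using (∁?)

module _ {a} {A : Set a} where

  ∃-∈ : ∀ {xs : List A} → 1 ≤ length xs → ∃ (_∈ xs)
  ∃-∈ {x ∷ _} _ = x , here refl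

  TwoDistinct : List A → Set a
  TwoDistinct xs = ∃₂ λ x y → x ∈ xs × y ∈ xs × x ≢ y

  twoDistinct : ∀ {xs} → Unique xs → 2 ≤ length xs → TwoDistinct xs
  twoDistinct {x ∷ y ∷ _} ((x≢y ∷ _) ∷ _) _ = x , y , here refl , there (here refl) , x≢y
  twoDistinct {_ ∷ []} _ (s≤s ())

  length-filter+length-filter-∁ : ∀ {p} {P : Pred A p} (P? : Decidable₁ P) xs →
    length (filter P? xs) + length (filter (∁? P?) xs) ≡ length xs
  length-filter+length-filter-∁ P? [] = refl
  length-filter+length-filter-∁ P? (x ∷ xs) with P? x
  ... | yes _ = cong suc (length-filter+length-filter-∁ P? xs)
  ... | no _  = trans (ℕP.+-suc _ _) (cong suc (length-filter+length-filter-∁ P? xs))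

  ∈-─⁻ : ∀ {x y : A} xs (x∈xs : x ∈ xs) → y ∈ xs ─ x∈xs → y ∈ xs
  ∈-─⁻ (_ ∷ _)  (here _)    y∈           = there y∈
  ∈-─⁻ (_ ∷ _)  (there x∈)  (here refl)  = here refl
  ∈-─⁻ (_ ∷ xs) (there x∈)  (there y∈)   = there (∈-─⁻ xs x∈ y∈)

  ∈-─⁺ : ∀ {x y : A} xs (x∈xs : x ∈ xs) → y ∈ xs → y ≡ x ⊎ y ∈ xs ─ x∈xs
  ∈-─⁺ (_ ∷ _)  (here refl) (here refl) = inj₁ refl
  ∈-─⁺ (_ ∷ _)  (here _)    (there y∈)  = inj₂ y∈
  ∈-─⁺ (_ ∷ _)  (there _)   (here refl) = inj₂ (here refl)
  ∈-─⁺ (_ ∷ xs) (there x∈)  (there y∈)  with ∈-─⁺ xs x∈ y∈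
  ... | inj₁ y≡x  = inj₁ y≡x
  ... | inj₂ y∈′  = inj₂ (there y∈′)

  length-─ : ∀ {x : A} xs (x∈xs : x ∈ xs) → length xs ≡ suc (length (xs ─ x∈xs))
  length-─ xs x∈xs = length-removeAt′ xs (Any.index x∈xs)

-- Connected components of a decidable relation on a finite set

module ReachableSet {a ℓ} {A : Set a} {_∼_ : Rel A ℓ} (_∼?_ : Decidable _∼_) (V : List A) where

  _∼ⱽ_ : Rel A (a ⊔ ℓ)
  x ∼ⱽ y = x ∈ V × y ∈ V × x ∼ y

  record Component (s : A) : Set (a ⊔ ℓ) where
    field
      members   : List A
      s∈members : s ∈ members
      members⊆V : ∀ {u} → u ∈ members → u ∈ V
      reachable : ∀ {u} → u ∈ members → Star _∼ⱽ_ s u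
      closed    : ∀ {u w} → u ∈ members → w ∈ V → u ∼ w → w ∈ members

  private
    record Search (s : A) : Set (a ⊔ ℓ) where
      field
        visited unvisited : List A
        s∈visited   : s ∈ visited
        visited⊆V   : ∀ {u} → u ∈ visited → u ∈ V
        unvisited⊆V : ∀ {u} → u ∈ unvisited → u ∈ V
        V⊆visited∪unvisited : ∀ {w} → w ∈ V → w ∈ visited ⊎ w ∈ unvisited
        visited-reachable   : ∀ {u} → u ∈ visited → Star _∼ⱽ_ s u

    open Search

    start : ∀ {s} → s ∈ V → Search s
    start {s} s∈V = record
      { visited = [ s ] ; unvisited = V ; s∈visited = here refl
      ; visited⊆V = λ { (here refl) → s∈V } ; unvisited⊆V = λ u∈ → u∈
      ; V⊆visited∪unvisited = inj₂ ; visited-reachable = λ { (here refl) → ε } }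

    visit : ∀ {s x y} (S : Search s) → x ∈ visited S → (y∈ : y ∈ unvisited S) → x ∼ y → Search s
    visit {s} {x} {y} S x∈ y∈ x∼y = record
      { visited = y ∷ visited S ; unvisited = unvisited S ─ y∈
      ; s∈visited = there (s∈visited S)
      ; visited⊆V = λ { (here refl) → unvisited⊆V S y∈ ; (there u∈) → visited⊆V S u∈ }
      ; unvisited⊆V = unvisited⊆V S ∘ ∈-─⁻ (unvisited S) y∈
      ; V⊆visited∪unvisited = cover
      ; visited-reachable = reach }
      where
      cover : ∀ {w} → w ∈ V → w ∈ y ∷ visited S ⊎ w ∈ unvisited S ─ y∈
      cover w∈V with V⊆visited∪unvisited S w∈V
      ... | inj₁ w∈ = inj₁ (there w∈)
      ... | inj₂ w∈ with ∈-─⁺ (unvisited S) y∈ w∈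
      ...   | inj₁ refl = inj₁ (here refl)
      ...   | inj₂ w∈′  = inj₂ w∈′
      reach : ∀ {u} → u ∈ y ∷ visited S → Star _∼ⱽ_ s u
      reach (here refl) =
        visited-reachable S x∈ ◅◅ ((visited⊆V S x∈ , unvisited⊆V S y∈ , x∼y) ◅ ε)
      reach (there u∈)  = visited-reachable S u∈

    explore : ∀ {s} (S : Search s) →
      Component s ⊎ ∃ λ (S′ : Search s) → length (unvisited S) ≡ suc (length (unvisited S′))
    explore S with any? (λ y → any? (_∼? y) (visited S)) (unvisited S)
    ... | no stuck = inj₁ record
      { members = visited S ; s∈members = s∈visited S ; members⊆V = visited⊆V S
      ; reachable = visited-reachable S ; closed = closed }
      where
      closed : ∀ {u w} → u ∈ visited S → w ∈ V → u ∼ w → w ∈ visited S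
      closed u∈ w∈V u∼w with V⊆visited∪unvisited S w∈V
      ... | inj₁ w∈ = w∈
      ... | inj₂ w∈ = ⊥-elim (stuck (lose w∈ (lose u∈ u∼w)))
    ... | yes next with find next
    ...   | y , y∈ , some with find some
    ...     | x , x∈ , x∼y = inj₂ (visit S x∈ y∈ x∼y , length-─ (unvisited S) y∈)

    run : ∀ {s} n (S : Search s) → length (unvisited S) < n → Component s
    run zero    S ()
    run (suc n) S |S|<1+n with explore S
    ... | inj₁ C             = C
    ... | inj₂ (S′ , shrink) = run n S′ (ℕP.≤-pred (subst (_< suc n) shrink |S|<1+n))

  component : ∀ {s} → s ∈ V → Component s
  component s∈V = run (suc (length V)) (start s∈V) ℕP.≤-refl

private
  i+k-[j+k]≡i-j : ∀ i j k → (i ℤ.+ k) ℤ.- (j ℤ.+ k) ≡ i ℤ.- j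
  i+k-[j+k]≡i-j = solve-∀

  j+[i-j]≡i : ∀ i j → j ℤ.+ (i ℤ.- j) ≡ i
  j+[i-j]≡i = solve-∀

  i+j-j≡i : ∀ i j → (i ℤ.+ j) ℤ.- j ≡ i
  i+j-j≡i = solve-∀

infixl 6 _⊕_
infix 8 ⊝_

_⊕_ : Cell → Cell → Cell
(x , y) ⊕ (tx , ty) = (x ℤ.+ tx , y ℤ.+ ty)

⊝_ : Cell → Cell
⊝ (x , y) = (ℤ.- x , ℤ.- y)

⊕-assoc : ∀ c u v → c ⊕ u ⊕ v ≡ c ⊕ (u ⊕ v)
⊕-assoc (x , y) (ux , uy) (vx , vy) = cong₂ _,_ (ℤP.+-assoc x ux vx) (ℤP.+-assoc y uy vy)

⊕-⊝-cancel : ∀ c t → c ⊕ t ⊕ ⊝ t ≡ c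
⊕-⊝-cancel (x , y) (tx , ty) = cong₂ _,_ (i+j-j≡i x tx) (i+j-j≡i y ty)

⊕-cancelʳ : ∀ {c d} t → c ⊕ t ≡ d ⊕ t → c ≡ d
⊕-cancelʳ {c} {d} t eq = begin
  c             ≡⟨ ⊕-⊝-cancel c t ⟨
  c ⊕ t ⊕ ⊝ t   ≡⟨ cong (_⊕ ⊝ t) eq ⟩
  d ⊕ t ⊕ ⊝ t   ≡⟨ ⊕-⊝-cancel d t ⟩
  d             ∎
  where open ≡-Reasoning

⊕-difference : ∀ a b → b ⊕ (a ⊕ ⊝ b) ≡ a
⊕-difference (ax , ay) (bx , by) = cong₂ _,_ (j+[i-j]≡i ax bx) (j+[i-j]≡i ay by)

∈-shift⁺ : ∀ {c A} t → c ∈ A → c ⊕ t ∈ shift t A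
∈-shift⁺ t = ∈-map⁺ (_⊕ t)

∈-shift⁻ : ∀ {x A} t → x ∈ shift t A → ∃ λ c → c ∈ A × x ≡ c ⊕ t
∈-shift⁻ t = ∈-map⁻ (_⊕ t)

EdgeAdj-shift : ∀ c d t → EdgeAdj c d → EdgeAdj (c ⊕ t) (d ⊕ t)
EdgeAdj-shift (x₁ , y₁) (x₂ , y₂) (tx , ty) =
  subst (_≡ 1) (sym (cong₂ (λ i j → ℤ.∣ i ∣ + ℤ.∣ j ∣)
                          (i+k-[j+k]≡i-j x₁ x₂ tx) (i+k-[j+k]≡i-j y₁ y₂ ty)))

EdgeAdj-sym : ∀ c d → EdgeAdj c d → EdgeAdj d c
EdgeAdj-sym (x₁ , y₁) (x₂ , y₂) =
  subst (_≡ 1) (cong₂ _+_ (ℤP.∣i-j∣≡∣j-i∣ x₁ x₂) (ℤP.∣i-j∣≡∣j-i∣ y₁ y₂))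

AdjIn-sym : ∀ {A c d} → AdjIn A c d → AdjIn A d c
AdjIn-sym {c = c} {d} (c∈ , d∈ , c~d) = d∈ , c∈ , EdgeAdj-sym c d c~d

Star-AdjIn-mono : ∀ {A B} → A ⊆ₛ B → ∀ {x y} → Star (AdjIn A) x y → Star (AdjIn B) x y
Star-AdjIn-mono A⊆B = Star.map λ (c∈ , d∈ , c~d) → A⊆B c∈ , A⊆B d∈ , c~d

shift-EdgeConnected : ∀ {A} t → EdgeConnected A → EdgeConnected (shift t A)
shift-EdgeConnected {A} t conn x∈ y∈ with ∈-shift⁻ t x∈ | ∈-shift⁻ t y∈
... | c , c∈ , refl | d , d∈ , refl = Star.gmap (_⊕ t) shiftStep (conn c∈ d∈)
  where
  shiftStep : ∀ {c d} → AdjIn A c d → AdjIn (shift t A) (c ⊕ t) (d ⊕ t)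
  shiftStep {c} {d} (c∈ , d∈ , c~d) = ∈-shift⁺ t c∈ , ∈-shift⁺ t d∈ , EdgeAdj-shift c d t c~d

hub⇒EdgeConnected : ∀ {A h} → (∀ {x} → x ∈ A → Star (AdjIn A) x h) → EdgeConnected A
hub⇒EdgeConnected toHub x∈ y∈ = toHub x∈ ◅◅ Star.reverse AdjIn-sym (toHub y∈)

singleton-IsPolyomino : ∀ c → IsPolyomino [ c ]
singleton-IsPolyomino c = record
  { unique = [] ∷ [] ; nonempty = s≤s z≤n
  ; connected = λ { (here refl) (here refl) → ε } }

module _ {a ℓ₁ ℓ₂} (O : StrictTotalOrder a ℓ₁ ℓ₂) where
  open StrictTotalOrder O using (Carrier; module Eq; irrefl; compare) renaming (_<_ to _⊏_; trans to ⊏-trans)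

  record Maximum (xs : List Carrier) : Set (a ⊔ ℓ₂) where
    field
      max       : Carrier
      max∈      : max ∈ xs
      max-bound : ∀ {x} → x ∈ xs → ¬ max ⊏ x

  maximum : ∀ xs → 1 ≤ length xs → Maximum xs
  maximum (x ∷ []) _ = record
    { max = x ; max∈ = here refl ; max-bound = λ { (here refl) → irrefl Eq.refl } }
  maximum (x ∷ xs@(_ ∷ _)) _ = extend (maximum xs (s≤s z≤n))
    where
    keep : (M : Maximum xs) → ¬ Maximum.max M ⊏ x → Maximum (x ∷ xs)
    keep M m⋢x = record
      { max = max ; max∈ = there max∈
      ; max-bound = λ { (here refl) → m⋢x ; (there y∈) → max-bound y∈ } }
      where open Maximum M

    extend : Maximum xs → Maximum (x ∷ xs)
    extend M with compare x (Maximum.max M)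
    ... | tri< _ _ m⋢x = keep M m⋢x
    ... | tri≈ _ _ m⋢x = keep M m⋢x
    ... | tri> _ _ m⊏x = record
      { max = x ; max∈ = here refl
      ; max-bound = λ { (here refl) → irrefl Eq.refl
                      ; (there y∈) x⊏y → Maximum.max-bound M y∈ (⊏-trans m⊏x x⊏y) } }

lexOrder : StrictTotalOrder _ _ _
lexOrder = ×-strictTotalOrder ℤP.<-strictTotalOrder ℤP.<-strictTotalOrder

open StrictTotalOrder lexOrder using () renaming (_<_ to _<ₗ_; _<?_ to _<ₗ?_; compare to compareₗ)

<ₗ-shift : ∀ {c d} t → c <ₗ d → c ⊕ t <ₗ d ⊕ t
<ₗ-shift {_ , _} {_ , _} (tx , _)  (inj₁ x₁<x₂)         = inj₁ (ℤP.+-monoˡ-< tx x₁<x₂)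
<ₗ-shift {_ , _} {_ , _} (_ , ty)  (inj₂ (refl , y₁<y₂)) = inj₂ (refl , ℤP.+-monoˡ-< ty y₁<y₂)

<ₗ-unshift : ∀ {c d} t → c ⊕ t <ₗ d ⊕ t → c <ₗ d
<ₗ-unshift {c} {d} t = subst₂ _<ₗ_ (⊕-⊝-cancel c t) (⊕-⊝-cancel d t) ∘ <ₗ-shift (⊝ t)

≮ₗ-antisym : ∀ {c d} → ¬ c <ₗ d → ¬ d <ₗ c → c ≡ d
≮ₗ-antisym {c} {d} c≮d d≮c with compareₗ c d
... | tri< c<d _ _ = ⊥-elim (c≮d c<d)
... | tri≈ _ c≈d _ = ≡×≡⇒≡ c≈d
... | tri> _ _ d<c = ⊥-elim (d≮c d<c)

lexMaximum : ∀ xs → 1 ≤ length xs → Maximum lexOrder xs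
lexMaximum = maximum lexOrder

lexMinimum : ∀ xs → 1 ≤ length xs → Maximum (Flip.strictTotalOrder lexOrder) xs
lexMinimum = maximum (Flip.strictTotalOrder lexOrder)

Overlap : CellSet → Cell → Cell → Set
Overlap p u w = ∃[ c ] (c ∈ shift u p × c ∈ shift w p)

overlap? : ∀ p → Decidable (Overlap p)
overlap? p u w with any? (_∈? shift w p) (shift u p)
... | yes common = yes (find common)
... | no  none   = no λ (c , c∈u , c∈w) → none (lose c∈u c∈w)

module _ {p : CellSet} where

  InstanceAt-mono : ∀ {X Y t} → X ⊆ₛ Y → InstanceAt p X t → InstanceAt p Y t
  InstanceAt-mono X⊆Y inst x∈ = X⊆Y (inst x∈)

  InstanceAt-shift : ∀ {X t} v → InstanceAt p X t → InstanceAt p (shift v X) (t ⊕ v)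
  InstanceAt-shift {t = t} v inst x∈ with ∈-shift⁻ (t ⊕ v) x∈
  ... | c , c∈p , refl = subst (_∈ shift v _) (⊕-assoc c t v) (∈-shift⁺ v (inst (∈-shift⁺ t c∈p)))

  HasAtLeastInstances-shift : ∀ {k X} v → HasAtLeastInstances k p X → HasAtLeastInstances k p (shift v X)
  HasAtLeastInstances-shift v (ts , refl , ts-unique , ts-inst) =
    map (_⊕ v) ts , length-map (_⊕ v) ts , UniqueP.map⁺ (⊕-cancelʳ v) ts-unique ,
    AllP.map⁺ (All.map (InstanceAt-shift v) ts-inst)

  HasAtLeastInstances-union : ∀ {m n X Y Z} → X ⊆ₛ Z → Y ⊆ₛ Z →
    (∀ {t} → InstanceAt p X t → InstanceAt p Y t → ⊥) →
    HasAtLeastInstances m p X → HasAtLeastInstances n p Y → HasAtLeastInstances (m + n) p Z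
  HasAtLeastInstances-union X⊆Z Y⊆Z disjoint
    (ts , refl , ts-unique , ts-inst) (us , refl , us-unique , us-inst) =
    ts ++ us , length-++ ts ,
    UniqueP.++⁺ ts-unique us-unique
      (λ (t∈ts , t∈us) → disjoint (All.lookup ts-inst t∈ts) (All.lookup us-inst t∈us)) ,
    AllP.++⁺ (All.map (InstanceAt-mono X⊆Z) ts-inst) (All.map (InstanceAt-mono Y⊆Z) us-inst)

  instance-not-within-cell : TwoDistinct p → ∀ t a → ¬ (∀ {x} → x ∈ shift t p → x ≡ a)
  instance-not-within-cell (_ , _ , c₁∈ , c₂∈ , c₁≢c₂) t a within =
    c₁≢c₂ (⊕-cancelʳ t (trans (within (∈-shift⁺ t c₁∈)) (sym (within (∈-shift⁺ t c₂∈)))))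

-- Gluing two polyominoes at a single cell

module Gluing {Q₁ Q₂ : CellSet} (Q₁-poly : IsPolyomino Q₁) (Q₂-poly : IsPolyomino Q₂) where
  private
    module Q₁ = IsPolyomino Q₁-poly
    module Q₂ = IsPolyomino Q₂-poly

  open Maximum (lexMaximum Q₁ Q₁.nonempty) renaming (max to a; max∈ to a∈Q₁; max-bound to Q₁≤a)
  open Maximum (lexMinimum Q₂ Q₂.nonempty) renaming (max to b; max∈ to b∈Q₂; max-bound to b≤Q₂)

  Q₂′ : CellSet
  Q₂′ = shift (a ⊕ ⊝ b) Q₂

  -- Every cell of Q₂′ is ≥ a, so the filter drops only the shared cell a.
  glued : CellSet
  glued = Q₁ ++ filter (a <ₗ?_) Q₂′

  a∈Q₂′ : a ∈ Q₂′
  a∈Q₂′ = subst (_∈ Q₂′) (⊕-difference a b) (∈-shift⁺ (a ⊕ ⊝ b) b∈Q₂)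

  a≤Q₂′ : ∀ {x} → x ∈ Q₂′ → ¬ x <ₗ a
  a≤Q₂′ x∈ x<a with ∈-shift⁻ (a ⊕ ⊝ b) x∈
  ... | c , c∈Q₂ , refl =
    b≤Q₂ c∈Q₂ (<ₗ-unshift (a ⊕ ⊝ b) (subst (c ⊕ (a ⊕ ⊝ b) <ₗ_) (sym (⊕-difference a b)) x<a))

  Q₁∩Q₂′≡a : ∀ {x} → x ∈ Q₁ → x ∈ Q₂′ → x ≡ a
  Q₁∩Q₂′≡a x∈Q₁ x∈Q₂′ = ≮ₗ-antisym (a≤Q₂′ x∈Q₂′) (Q₁≤a x∈Q₁)

  Q₁⊆glued : Q₁ ⊆ₛ glued
  Q₁⊆glued = ∈-++⁺ˡ

  Q₂′⊆glued : Q₂′ ⊆ₛ glued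
  Q₂′⊆glued {x} x∈ with a <ₗ? x
  ... | yes a<x = ∈-++⁺ʳ Q₁ (∈-filter⁺ (a <ₗ?_) x∈ a<x)
  ... | no  a≮x = subst (_∈ glued) (sym (≮ₗ-antisym (a≤Q₂′ x∈) a≮x)) (Q₁⊆glued a∈Q₁)

  glued-IsPolyomino : IsPolyomino glued
  glued-IsPolyomino = record
    { unique    = UniqueP.++⁺ Q₁.unique
                    (UniqueP.filter⁺ (a <ₗ?_) (UniqueP.map⁺ (⊕-cancelʳ (a ⊕ ⊝ b)) Q₂.unique))
                    (λ (x∈Q₁ , x∈F) → Q₁≤a x∈Q₁ (proj₂ (∈-filter⁻ (a <ₗ?_) {xs = Q₂′} x∈F)))
    ; nonempty  = ∈-length (Q₁⊆glued a∈Q₁)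
    ; connected = hub⇒EdgeConnected toA }
    where
    toA : ∀ {x} → x ∈ glued → Star (AdjIn glued) x a
    toA x∈ with ∈-++⁻ Q₁ x∈
    ... | inj₁ x∈Q₁ = Star-AdjIn-mono Q₁⊆glued (Q₁.connected x∈Q₁ a∈Q₁)
    ... | inj₂ x∈F  = Star-AdjIn-mono Q₂′⊆glued
                        (shift-EdgeConnected (a ⊕ ⊝ b) Q₂.connected x∈Q₂′ a∈Q₂′)
      where
      x∈Q₂′ : _ ∈ Q₂′
      x∈Q₂′ = proj₁ (∈-filter⁻ (a <ₗ?_) {xs = Q₂′} x∈F)

  glued-size : suc (size glued) ≤ size Q₁ + size Q₂
  glued-size = begin
    suc (length glued)                  ≡⟨ cong suc (length-++ Q₁) ⟩
    suc (length Q₁ + length F)          ≡⟨ ℕP.+-suc (length Q₁) (length F) ⟨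
    length Q₁ + suc (length F)          ≤⟨ ℕP.+-monoʳ-≤ (length Q₁) (filter-notAll (a <ₗ?_) Q₂′ a∉F) ⟩
    length Q₁ + length Q₂′              ≡⟨ cong (length Q₁ +_) (length-map _ Q₂) ⟩
    length Q₁ + length Q₂               ∎
    where
    open ℕP.≤-Reasoning
    F : CellSet
    F = filter (a <ₗ?_) Q₂′
    a∉F : Any (¬_ ∘ (a <ₗ_)) Q₂′
    a∉F = Any.map (λ { refl → a≤Q₂′ a∈Q₂′ }) a∈Q₂′

  glued-instances : ∀ {p k₁ k₂} → TwoDistinct p →
    HasAtLeastInstances k₁ p Q₁ → HasAtLeastInstances k₂ p Q₂ → HasAtLeastInstances (k₁ + k₂) p glued
  glued-instances p-two has₁ has₂ =
    HasAtLeastInstances-union Q₁⊆glued Q₂′⊆glued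
      (λ {t} in₁ in₂ → instance-not-within-cell p-two t a λ x∈ → Q₁∩Q₂′≡a (in₁ x∈) (in₂ x∈))
      has₁ (HasAtLeastInstances-shift (a ⊕ ⊝ b) has₂)

record Packing (p : CellSet) (k n : ℕ) : Set where
  field
    cells             : CellSet
    cells-IsPolyomino : IsPolyomino cells
    cells-size        : size cells ≤ n
    cells-instances   : HasAtLeastInstances k p cells

module _ {p : CellSet} where

  polyomino-packing : ∀ {Q k} → IsPolyomino Q → HasAtLeastInstances k p Q → Packing p k (size Q)
  polyomino-packing Q-poly has = record
    { cells = _ ; cells-IsPolyomino = Q-poly ; cells-size = ℕP.≤-refl ; cells-instances = has }

  singleton-packing : ∀ {X c} → c ∈ X → Packing p 0 (size X)
  singleton-packing {c = c} c∈X = record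
    { cells = [ c ] ; cells-IsPolyomino = singleton-IsPolyomino c
    ; cells-size = ∈-length c∈X ; cells-instances = [] , refl , [] , [] }

  packing-mono : ∀ {k m n} → m ≤ n → Packing p k m → Packing p k n
  packing-mono m≤n P = record
    { cells = cells ; cells-IsPolyomino = cells-IsPolyomino
    ; cells-size = ℕP.≤-trans cells-size m≤n ; cells-instances = cells-instances }
    where open Packing P

  glue : ∀ {k₁ k₂ n₁ n₂} → TwoDistinct p →
    Packing p k₁ n₁ → Packing p k₂ n₂ → Packing p (k₁ + k₂) (pred (n₁ + n₂))
  glue p-two P₁ P₂ = record
    { cells = glued ; cells-IsPolyomino = glued-IsPolyomino
    ; cells-size = ℕP.suc[m]≤n⇒m≤pred[n]
        (ℕP.≤-trans glued-size (ℕP.+-mono-≤ (Packing.cells-size P₁) (Packing.cells-size P₂)))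
    ; cells-instances = glued-instances p-two (Packing.cells-instances P₁) (Packing.cells-instances P₂) }
    where open Gluing (Packing.cells-IsPolyomino P₁) (Packing.cells-IsPolyomino P₂)

-- Splitting off a component of overlapping instances

module Decomposition {p : CellSet} (p-poly : IsPolyomino p) where
  private
    module p = IsPolyomino p-poly

  c₀ : Cell
  c₀ = proj₁ (∃-∈ {xs = p} p.nonempty)

  c₀∈p : c₀ ∈ p
  c₀∈p = proj₂ (∃-∈ {xs = p} p.nonempty)

  record ComponentSplit (X V : List Cell) (s : Cell) : Set where
    field
      component           : List Cell
      A R                 : CellSet
      A-IsPolyomino       : IsPolyomino A
      R-unique            : Unique R
      size-split          : size A + size R ≡ size X
      component-reachable : ∀ {u} → u ∈ component → Star (InstAdj p X) s u
      component-inside    : ∀ {u} → u ∈ component → InstanceAt p A u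
      others-outside      : ∀ {u} → u ∈ V → u ∉ component → InstanceAt p R u
      s∈component         : s ∈ component

  componentSplit : ∀ {X V s} → Unique X → (∀ {u} → u ∈ V → InstanceAt p X u) → s ∈ V →
    ComponentSplit X V s
  componentSplit {X} {V} {s} X-unique V-inst s∈V = record
    { component = members ; A = A ; R = R
    ; A-IsPolyomino = record { unique = UniqueP.filter⁺ covered? X-unique
                             ; nonempty = ∈-length (inside s∈members (∈-shift⁺ s c₀∈p))
                             ; connected = hub⇒EdgeConnected toBase }
    ; R-unique = UniqueP.filter⁺ (∁? covered?) X-unique
    ; size-split = length-filter+length-filter-∁ covered? X
    ; component-reachable = λ u∈ →
        Star.map (λ (u∈V , w∈V , shared) → V-inst u∈V , V-inst w∈V , shared) (reachable u∈)
    ; component-inside = inside ; others-outside = outside ; s∈component = s∈members }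
    where
    open ReachableSet (overlap? p) V
    open Component (component s∈V)

    Covered : Pred Cell _
    Covered c = Any (λ u → c ∈ shift u p) members

    covered? : Decidable₁ Covered
    covered? c = any? (λ u → c ∈? shift u p) members

    A R : CellSet
    A = filter covered? X
    R = filter (∁? covered?) X

    inside : ∀ {u} → u ∈ members → InstanceAt p A u
    inside u∈ x∈ = ∈-filter⁺ covered? (V-inst (members⊆V u∈) x∈) (lose u∈ x∈)

    outside : ∀ {u} → u ∈ V → u ∉ members → InstanceAt p R u
    outside {u} u∈V u∉ {x} x∈ = ∈-filter⁺ (∁? covered?) (V-inst u∈V x∈) uncovered
      where
      uncovered : ¬ Covered x
      uncovered cov with find cov
      ... | w , w∈ , x∈w = u∉ (closed w∈ u∈V (x , x∈w , x∈))

    within : ∀ {u x y} → u ∈ members → x ∈ shift u p → y ∈ shift u p → Star (AdjIn A) x y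
    within {u} u∈ x∈ y∈ = Star-AdjIn-mono (inside u∈) (shift-EdgeConnected u p.connected x∈ y∈)

    linked : ∀ {w u x y} → Star _∼ⱽ_ w u → w ∈ members →
      x ∈ shift u p → y ∈ shift w p → Star (AdjIn A) x y
    linked ε w∈ x∈ y∈ = within w∈ x∈ y∈
    linked ((_ , w′∈V , m , m∈w , m∈w′) ◅ path) w∈ x∈ y∈ =
      linked path (closed w∈ w′∈V (m , m∈w , m∈w′)) x∈ m∈w′ ◅◅ within w∈ m∈w y∈

    toBase : ∀ {x} → x ∈ A → Star (AdjIn A) x (c₀ ⊕ s)
    toBase x∈A with find (proj₂ (∈-filter⁻ covered? {xs = X} x∈A))
    ... | u , u∈ , x∈u = linked (reachable u∈) s∈members x∈u (∈-shift⁺ s c₀∈p)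

  module Sides {X V s} (D : ComponentSplit X V s) {T : List Cell}
               (T⊆V : ∀ {u} → u ∈ T → u ∈ V) (T-unique : Unique T) where
    open ComponentSplit D

    inComponent? : Decidable₁ (_∈ component)
    inComponent? u = u ∈? component

    insideT outsideT : List Cell
    insideT  = filter inComponent? T
    outsideT = filter (∁? inComponent?) T

    sides-count : length insideT + length outsideT ≡ length T
    sides-count = length-filter+length-filter-∁ inComponent? T

    inside-instances : HasAtLeastInstances (length insideT) p A
    inside-instances = insideT , refl , UniqueP.filter⁺ inComponent? T-unique ,
      All.tabulate λ u∈ → component-inside (proj₂ (∈-filter⁻ inComponent? {xs = T} u∈))

    outsideT-in-R : All (InstanceAt p R) outsideT
    outsideT-in-R = All.tabulate λ u∈ →
      let (u∈T , u∉) = ∈-filter⁻ (∁? inComponent?) {xs = T} u∈ in others-outside (T⊆V u∈T) u∉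

    outside-instances : HasAtLeastInstances (length outsideT) p R
    outside-instances = outsideT , refl , UniqueP.filter⁺ (∁? inComponent?) T-unique , outsideT-in-R

    outsideT-shorter : s ∈ T → length outsideT < length T
    outsideT-shorter s∈T = subst (length outsideT <_) sides-count
      (ℕP.+-monoˡ-≤ (length outsideT) (∈-length (∈-filter⁺ inComponent? s∈T s∈component)))

    outsideT-empty⊎R-inhabited : outsideT ≡ [] ⊎ ∃ (_∈ R)
    outsideT-empty⊎R-inhabited = emptyOrCell outsideT-in-R
      where
      emptyOrCell : ∀ {us} → All (InstanceAt p R) us → us ≡ [] ⊎ ∃ (_∈ R)
      emptyOrCell []         = inj₁ refl
      emptyOrCell (inst ∷ _) = inj₂ (_ , inst (∈-shift⁺ _ c₀∈p))

-- Compaction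

module Compaction {p : CellSet} (p-poly : IsPolyomino p) (p-large : 2 ≤ size p) where
  open Decomposition p-poly

  p-two : TwoDistinct p
  p-two = twoDistinct (IsPolyomino.unique p-poly) p-large

  Compactable : ℕ → Set
  Compactable k = ∀ {X c} → Unique X → c ∈ X → HasAtLeastInstances k p X → Packing p k (size X)

  module SidePackings {X V s} (D : ComponentSplit X V s) {T : List Cell}
                      (T⊆V : ∀ {u} → u ∈ T → u ∈ V) (T-unique : Unique T) where
    open ComponentSplit D
    open Sides D T⊆V T-unique public

    glue-sides : Compactable (length outsideT) → ∀ {c} → c ∈ R → Packing p (length T) (pred (size X))
    glue-sides compact c∈R = subst₂ (Packing p) sides-count (cong pred size-split)
      (glue p-two (polyomino-packing A-IsPolyomino inside-instances)
                  (compact R-unique c∈R outside-instances))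

    inside-packing : outsideT ≡ [] → Packing p (length T) (size X)
    inside-packing outside≡[] = subst₂ (Packing p) count size-split
      (packing-mono (ℕP.m≤m+n (size A) (size R)) (polyomino-packing A-IsPolyomino inside-instances))
      where
      count : length insideT ≡ length T
      count = trans (sym (ℕP.+-identityʳ _))
                    (subst (λ o → length insideT + length o ≡ length T) outside≡[] sides-count)

  compactable : ∀ k → Compactable k
  compactable = <-rec Compactable step
    where
    step : ∀ k → (∀ {j} → j < k → Compactable j) → Compactable k
    step _ _   _        c∈X ([] , refl , _ , _) = singleton-packing c∈X
    step _ rec {X} X-unique _ (s ∷ T , refl , T-unique , T-inst) = byOutside outsideT-empty⊎R-inhabited
      where
      D : ComponentSplit X (s ∷ T) s
      D = componentSplit X-unique (All.lookup T-inst) (here refl)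
      open ComponentSplit D using (R)
      open SidePackings D id T-unique

      byOutside : outsideT ≡ [] ⊎ ∃ (_∈ R) → Packing p (length (s ∷ T)) (size X)
      byOutside (inj₁ outside≡[]) = inside-packing outside≡[]
      byOutside (inj₂ (_ , c∈R))  =
        packing-mono ℕP.pred[n]≤n (glue-sides (rec (outsideT-shorter (here refl))) c∈R)

lemma2p2 : (N : ℕ) → 1 ≤ N → (p : CellSet) → IsPolyomino p → 2 ≤ size p →
    (P : CellSet) → IsPolyomino P → HasAtLeastInstances N p P →
    ((Q : CellSet) → IsPolyomino Q → HasAtLeastInstances N p Q → size P ≤ size Q) →
    InstanceGraphConnected p P
lemma2p2 N _ p p-poly p-large P P-poly (ts , refl , ts-unique , ts-inst) minimal {s} {t} s-inst t-inst =
  byComponent (t ∈? component)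
  where
  open Decomposition p-poly
  open Compaction p-poly p-large

  V-inst : ∀ {u} → u ∈ s ∷ t ∷ ts → InstanceAt p P u
  V-inst (here refl)         = s-inst
  V-inst (there (here refl)) = t-inst
  V-inst (there (there u∈))  = All.lookup ts-inst u∈

  D : ComponentSplit P (s ∷ t ∷ ts) s
  D = componentSplit (IsPolyomino.unique P-poly) V-inst (here refl)
  open ComponentSplit D
  open SidePackings D (there ∘ there) ts-unique

  byComponent : Dec (t ∈ component) → Star (InstAdj p P) s t
  byComponent (yes t∈) = component-reachable t∈
  byComponent (no t∉)  = ⊥-elim (ℕP.<-irrefl refl (ℕP.m≤pred[n]⇒suc[m]≤n {{P-nonZero}} P≤pred[P]))
    where
    open Packing (glue-sides (compactable _) (others-outside (there (here refl)) t∉ (∈-shift⁺ t c₀∈p)))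
    P-nonZero : NonZero (size P)
    P-nonZero = >-nonZero (IsPolyomino.nonempty P-poly)
    P≤pred[P] : size P ≤ pred (size P)
    P≤pred[P] = ℕP.≤-trans (minimal cells cells-IsPolyomino cells-instances) cells-size
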